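{- For every positive integer $L$, $$\sum_{n\ge 0}b_2(L,n)q^n=q^2\frac{1-q^{L-1}}{1-q}(-q^2;q)_{L-2}.$$
   Context: A partition of $n$ is a non-increasing finite sequence of positive integers summing to $n$ (the empty partition is the unique partition of $0$). Its Young diagram has $\lambda_i$ left-justified cells in row $i$; with $\lambda'_j$ the number of cells in column $j$, the hook length of cell $(i,j)$ is $h(i,j)=\lambda_i+\lambda'_j-i-j+1$. For a positive integer $L$, $b_2(L,n)$ is the total number of cells of hook length $2$, summed over all partitions of $n$ into distinct parts with largest part at most $L$. Here $(a;q)_N=\prod_{k=0}^{N-1}(1-aq^k)$ for $N\ge 0$, and for $N<0$ the standard convention $(a;q)_{N}=1/(aq^{N};q)_{ -N}$ is used (so for $L=1$ the right-hand side is $0$). The identity is one of formal power series in $q$. -}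

module Defs where

open import Data.Nat as ℕ using (ℕ; zero; suc; _+_; _∸_; _≤?_; _≟_)
open import Data.Integer as ℤ using (ℤ; +_; -_)
open import Data.List using (List; []; _∷_; _++_; map; filter; length; upTo; zip; foldr)
open import Data.Nat.ListAction using (sum)
open import Data.Product using (_×_; _,_)
open import Relation.Nullary.Decidable using (does)
open import Data.Bool using (if_then_else_)

-- All partitions into distinct parts with largest part at most L,
-- i.e. all subsets of {1,…,L}, each listed as a strictly decreasing list
-- (the parts λ₁ > λ₂ > … of the partition).
distinctPartsUpTo : ℕ → List (List ℕ)
distinctPartsUpTo zero    = [] ∷ []
distinctPartsUpTo (suc L) =
  distinctPartsUpTo L ++ map (suc L ∷_) (distinctPartsUpTo L)

distinctPartitions : ℕ → ℕ → List (List ℕ)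
distinctPartitions L n = filter (λ μ → sum μ ≟ n) (distinctPartsUpTo L)

-- λ'_j : number of cells in column j (j ≥ 1) = number of parts ≥ j.
conj : List ℕ → ℕ → ℕ
conj μ j = length (filter (λ p → j ≤? p) μ)

-- Number of cells (i,j) (1-indexed, 1 ≤ j ≤ λ_i) with hook length
-- h(i,j) = λ_i + λ'_j - i - j + 1 equal to 2, i.e. (subtraction-free)
-- λ_i + λ'_j + 1 = i + j + 2.
hook2Count : List ℕ → ℕ
hook2Count μ = sum (map row (zip (upTo (length μ)) μ))
  where
  row : ℕ × ℕ → ℕ
  row (i0 , li) =
    length (filter (λ j0 → (li + conj μ (suc j0) + 1) ≟ (suc i0 + suc j0 + 2))
                   (upTo li))

b2 : ℕ → ℕ → ℕ
b2 L n = sum (map hook2Count (distinctPartitions L n))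

Series : Set
Series = ℕ → ℤ

sumℤ : List ℤ → ℤ
sumℤ = foldr ℤ._+_ (+ 0)

X^ : ℕ → Series
X^ e n = if does (n ≟ e) then + 1 else + 0

one : Series
one = X^ 0

_⊕_ : Series → Series → Series
(f ⊕ g) n = f n ℤ.+ g n

_⊖_ : Series → Series → Series
(f ⊖ g) n = f n ℤ.- g n

_⊛_ : Series → Series → Series
(f ⊛ g) n = sumℤ (map (λ k → f k ℤ.* g (n ∸ k)) (upTo (suc n)))

infixl 7 _⊛_
infixl 6 _⊕_ _⊖_

prodS : List Series → Series
prodS = foldr _⊛_ one

-- Multiplicative inverse of a series with constant term 1.
-- invList f n = [g_n, g_{n-1}, …, g_0], where g = 1/f, via
-- g_0 = 1, g_{n+1} = - Σ_{k=1}^{n+1} f_k g_{n+1-k}.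
nth : List ℤ → ℕ → ℤ
nth []       _       = + 0
nth (x ∷ xs) zero    = x
nth (x ∷ xs) (suc k) = nth xs k

invList : Series → ℕ → List ℤ
invList f zero    = + 1 ∷ []
invList f (suc n) =
  (- sumℤ (map (λ k → f (suc k) ℤ.* nth prev k) (upTo (suc n)))) ∷ prev
  where prev = invList f n

inv : Series → Series
inv f n = nth (invList f n) 0

-- (-q²;q)_{L-2} for L ≥ 1, indexed by L-1 (so the index N = L-2 ≥ -1):
--   N = j ≥ 0 :  ∏_{k=0}^{j-1} (1 - (-q²) q^k) = ∏_{k<j} (1 + q^{k+2})
--   N = -1    :  1 / ((-q²)q^{-1};q)_1 = 1/(1+q)
pochNegQ2 : ℕ → Series
pochNegQ2 zero    = inv (one ⊕ X^ 1)
pochNegQ2 (suc j) = prodS (map (λ k → one ⊕ X^ (k + 2)) (upTo j))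

-- Right-hand side  q² (1 - q^{L-1})/(1 - q) (-q²;q)_{L-2}, for L = suc m.
rhs : ℕ → Series
rhs m = X^ 2 ⊛ (one ⊖ X^ m) ⊛ inv (one ⊖ X^ 1) ⊛ pochNegQ2 m

module Submission where

-- Write B_L = Σₙ b₂(L,n) qⁿ and P_K = (-q;q)_K for the generating function of partitions into
-- distinct parts ≤ K. When the largest part is λ₁ = K+2, the first row contains a cell of hook
-- length 2 exactly when λ₂ ≤ K (the cell in column K+1), and the remaining rows have the hook
-- lengths of (λ₂, λ₃, …). Sorting the partitions with parts ≤ K+2 by whether they contain K+2,
-- and then K+1, gives
--   B_{K+2} = (1 + q^{K+2}) B_{K+1} + q^{K+2} P_K,   B_1 = 0.
-- The right-hand side R_m = q² [m]_q (-q²;q)_{m-1}, where [m]_q = (1-q^m)/(1-q), obeys the same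
-- recurrence, since P_{j+1} = (1+q)(-q²;q)_j and (1+q^{a+1})[a+1]_q = (1+q^{a+2})[a]_q + q^a(1+q).

open import Defs
open import Data.Bool using (true; false; if_then_else_)
open import Data.Integer as ℤ using (ℤ; +_; -_; -[1+_])
import Data.Integer.Properties as ℤP
open import Algebra.Properties.CommutativeSemigroup ℤP.+-commutativeSemigroup using (interchange)
open import Data.List using (List; []; _∷_; _++_; _∷ʳ_; map; filter; length; upTo; applyUpTo; zip; replicate)
open import Data.List.Properties
  using (map-cong; map-applyUpTo; map-upTo; map-++; upTo-∷ʳ; ++-assoc; ++-identityʳ;
         filter-++; filter-accept; filter-reject; filter-none)
open import Data.List.Relation.Unary.All as All using (All; []; _∷_)
import Data.List.Relation.Unary.All.Properties as AllP
open import Data.Nat as ℕ using (ℕ; zero; suc; _+_; _∸_; _≤_; _<_; s≤s; _≟_; _≤?_)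
import Data.Nat.Properties as ℕP
open import Data.Nat.ListAction using (sum)
open import Data.Product using (uncurry)
open import Function using (_∘_; id; _⇔_; mk⇔; Equivalence)
open import Relation.Binary.Bundles using (Setoid)
open import Relation.Binary.PropositionalEquality
import Relation.Binary.Reasoning.Setoid as SetoidReasoning
open import Relation.Nullary using (yes; no; ¬_; does)
open import Relation.Unary using (Decidable)

module ≗-Reasoning = SetoidReasoning (ℕ →-setoid ℤ)
open Setoid (ℕ →-setoid ℤ) using () renaming (refl to ≗-refl; sym to ≗-sym; trans to ≗-trans)

map-upTo-suc : ∀ {A : Set} (F : ℕ → A) n → map F (upTo (suc n)) ≡ F 0 ∷ map (F ∘ suc) (upTo n)
map-upTo-suc F n = cong (F 0 ∷_) (trans (map-applyUpTo suc F n) (sym (map-upTo (F ∘ suc) n)))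

sumℤ-map-+ : ∀ {A : Set} (F G : A → ℤ) xs →
             sumℤ (map (λ x → F x ℤ.+ G x) xs) ≡ sumℤ (map F xs) ℤ.+ sumℤ (map G xs)
sumℤ-map-+ F G []       = refl
sumℤ-map-+ F G (x ∷ xs) =
  trans (cong (λ s → (F x ℤ.+ G x) ℤ.+ s) (sumℤ-map-+ F G xs))
        (interchange (F x) (G x) (sumℤ (map F xs)) (sumℤ (map G xs)))

sumℤ-map-neg : ∀ {A : Set} (F : A → ℤ) xs → sumℤ (map (λ x → - F x) xs) ≡ - sumℤ (map F xs)
sumℤ-map-neg F []       = refl
sumℤ-map-neg F (x ∷ xs) =
  trans (cong (λ s → - F x ℤ.+ s) (sumℤ-map-neg F xs)) (sym (ℤP.neg-distrib-+ (F x) _))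

sumℤ-map-0 : ∀ {A : Set} (xs : List A) → sumℤ (map (λ _ → + 0) xs) ≡ + 0
sumℤ-map-0 []       = refl
sumℤ-map-0 (x ∷ xs) = trans (ℤP.+-identityˡ _) (sumℤ-map-0 xs)

filter-≐-local : ∀ {A : Set} {P Q : A → Set} (P? : Decidable P) (Q? : Decidable Q) {xs} →
                 All (λ x → P x ⇔ Q x) xs → filter P? xs ≡ filter Q? xs
filter-≐-local P? Q? []                          = refl
filter-≐-local P? Q? {x ∷ xs} (Px⇔Qx ∷ P⇔Q) with P? x
... | yes Px = trans (cong (x ∷_) (filter-≐-local P? Q? P⇔Q))
                     (sym (filter-accept Q? (Equivalence.to Px⇔Qx Px)))
... | no ¬Px = trans (filter-≐-local P? Q? P⇔Q)
                     (sym (filter-reject Q? (¬Px ∘ Equivalence.from Px⇔Qx)))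

-- Formal power series

0S : Series
0S _ = + 0

ones : Series
ones _ = + 1

q·_ : Series → Series
(q· f) zero    = + 0
(q· f) (suc n) = f n

q^_·_ : ℕ → Series → Series
q^ zero  · f = f
q^ suc e · f = q· (q^ e · f)

1+q^_·_ : ℕ → Series → Series
1+q^ c · f = f ⊕ q^ c · f

infixr 8 q·_ q^_·_ 1+q^_·_

[_]q : ℕ → Series
[ zero  ]q _       = + 0
[ suc m ]q zero    = + 1
[ suc m ]q (suc n) = [ m ]q n

⊕-cong : ∀ {f f′ g g′} → f ≗ f′ → g ≗ g′ → f ⊕ g ≗ f′ ⊕ g′
⊕-cong p q n = cong₂ ℤ._+_ (p n) (q n)

⊕-congˡ : ∀ f {g g′} → g ≗ g′ → f ⊕ g ≗ f ⊕ g′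
⊕-congˡ f = ⊕-cong (≗-refl {f})

⊖-cong : ∀ {f f′ g g′} → f ≗ f′ → g ≗ g′ → f ⊖ g ≗ f′ ⊖ g′
⊖-cong p q n = cong₂ ℤ._-_ (p n) (q n)

⊕-assoc : ∀ f g h → (f ⊕ g) ⊕ h ≗ f ⊕ (g ⊕ h)
⊕-assoc f g h n = ℤP.+-assoc (f n) (g n) (h n)

⊕-interchange : ∀ f g h k → (f ⊕ g) ⊕ (h ⊕ k) ≗ (f ⊕ h) ⊕ (g ⊕ k)
⊕-interchange f g h k n = interchange (f n) (g n) (h n) (k n)

q·-cong : ∀ {f g} → f ≗ g → q· f ≗ q· g
q·-cong p zero    = refl
q·-cong p (suc n) = p n

q^-cong : ∀ e {f g} → f ≗ g → q^ e · f ≗ q^ e · g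
q^-cong zero    p = p
q^-cong (suc e) p = q·-cong (q^-cong e p)

1+q^-cong : ∀ c {f g} → f ≗ g → 1+q^ c · f ≗ 1+q^ c · g
1+q^-cong c p = ⊕-cong p (q^-cong c p)

q^-⊕ : ∀ e f g → q^ e · (f ⊕ g) ≗ q^ e · f ⊕ q^ e · g
q^-⊕ zero    f g n       = refl
q^-⊕ (suc e) f g zero    = refl
q^-⊕ (suc e) f g (suc n) = q^-⊕ e f g n

q^-0S : ∀ e → q^ e · 0S ≗ 0S
q^-0S zero    n       = refl
q^-0S (suc e) zero    = refl
q^-0S (suc e) (suc n) = q^-0S e n

q^-+ : ∀ a b f → q^ a · q^ b · f ≗ q^ (a + b) · f
q^-+ zero    b f n       = refl
q^-+ (suc a) b f zero    = refl
q^-+ (suc a) b f (suc n) = q^-+ a b f n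

q^-comm : ∀ a b f → q^ a · q^ b · f ≗ q^ b · q^ a · f
q^-comm a b f = begin
  q^ a · q^ b · f  ≈⟨ q^-+ a b f ⟩
  q^ (a + b) · f   ≡⟨ cong (q^_· f) (ℕP.+-comm a b) ⟩
  q^ (b + a) · f   ≈⟨ q^-+ b a f ⟨
  q^ b · q^ a · f  ∎
  where open ≗-Reasoning

q^-1+q^ : ∀ a c f → q^ a · 1+q^ c · f ≗ 1+q^ c · q^ a · f
q^-1+q^ a c f = ≗-trans (q^-⊕ a f (q^ c · f)) (⊕-congˡ (q^ a · f) (q^-comm a c f))

1+q^-comm : ∀ a b f → 1+q^ a · 1+q^ b · f ≗ 1+q^ b · 1+q^ a · f
1+q^-comm a b f = begin
  (f ⊕ q^ b · f) ⊕ q^ a · (f ⊕ q^ b · f)         ≈⟨ ⊕-congˡ (f ⊕ q^ b · f) (q^-1+q^ a b f) ⟩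
  (f ⊕ q^ b · f) ⊕ (q^ a · f ⊕ q^ b · q^ a · f)  ≈⟨ ⊕-interchange f _ _ _ ⟩
  (f ⊕ q^ a · f) ⊕ (q^ b · f ⊕ q^ b · q^ a · f)  ≈⟨ ⊕-congˡ (f ⊕ q^ a · f) (q^-⊕ b f (q^ a · f)) ⟨
  (f ⊕ q^ a · f) ⊕ q^ b · (f ⊕ q^ a · f)         ∎
  where open ≗-Reasoning

⊛-cong : ∀ {f f′ g g′} → f ≗ f′ → g ≗ g′ → f ⊛ g ≗ f′ ⊛ g′
⊛-cong p q n = cong sumℤ (map-cong (λ k → cong₂ ℤ._*_ (p k) (q (n ∸ k))) (upTo (suc n)))

⊛-unfold : ∀ f g n → (f ⊛ g) n ≡ f 0 ℤ.* g n ℤ.+ (q· ((f ∘ suc) ⊛ g)) n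
⊛-unfold f g zero    = refl
⊛-unfold f g (suc n) = cong sumℤ (map-upTo-suc (λ k → f k ℤ.* g (suc n ∸ k)) (suc n))

⊛-zeroˡ : ∀ f → 0S ⊛ f ≗ 0S
⊛-zeroˡ f n = sumℤ-map-0 (upTo (suc n))

⊛-identityˡ : ∀ f → one ⊛ f ≗ f
⊛-identityˡ f n = begin
  (one ⊛ f) n                         ≡⟨ ⊛-unfold one f n ⟩
  + 1 ℤ.* f n ℤ.+ (q· (0S ⊛ f)) n     ≡⟨ cong₂ ℤ._+_ (ℤP.*-identityˡ (f n)) (q^-cong 1 (⊛-zeroˡ f) n) ⟩
  f n ℤ.+ (q· 0S) n                   ≡⟨ cong (λ s → f n ℤ.+ s) (q^-0S 1 n) ⟩
  f n ℤ.+ + 0                         ≡⟨ ℤP.+-identityʳ (f n) ⟩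
  f n                                 ∎
  where open ≡-Reasoning

q·-⊛ : ∀ f g → q· f ⊛ g ≗ q· (f ⊛ g)
q·-⊛ f g n = trans (⊛-unfold (q· f) g n) (ℤP.+-identityˡ _)

⊛-q· : ∀ f g → f ⊛ q· g ≗ q· (f ⊛ g)
⊛-q· f g zero    = cong (λ s → s ℤ.+ + 0) (ℤP.*-zeroʳ (f 0))
⊛-q· f g (suc n) = begin
  (f ⊛ q· g) (suc n)                           ≡⟨ ⊛-unfold f (q· g) (suc n) ⟩
  f 0 ℤ.* g n ℤ.+ ((f ∘ suc) ⊛ q· g) n         ≡⟨ cong (λ s → f 0 ℤ.* g n ℤ.+ s) (⊛-q· (f ∘ suc) g n) ⟩
  f 0 ℤ.* g n ℤ.+ (q· ((f ∘ suc) ⊛ g)) n       ≡⟨ ⊛-unfold f g n ⟨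
  (f ⊛ g) n                                    ∎
  where open ≡-Reasoning

q^-⊛ : ∀ e f g → q^ e · f ⊛ g ≗ q^ e · (f ⊛ g)
q^-⊛ zero    f g = ≗-refl
q^-⊛ (suc e) f g = ≗-trans (q·-⊛ (q^ e · f) g) (q·-cong (q^-⊛ e f g))

⊛-q^ : ∀ e f g → f ⊛ q^ e · g ≗ q^ e · (f ⊛ g)
⊛-q^ zero    f g = ≗-refl
⊛-q^ (suc e) f g = ≗-trans (⊛-q· f (q^ e · g)) (q·-cong (⊛-q^ e f g))

X^≗q^·one : ∀ e → X^ e ≗ q^ e · one
X^≗q^·one zero    n       = refl
X^≗q^·one (suc e) zero    = refl
X^≗q^·one (suc e) (suc n) = X^≗q^·one e n

X^-⊛ : ∀ e f → X^ e ⊛ f ≗ q^ e · f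
X^-⊛ e f = ≗-trans (⊛-cong (X^≗q^·one e) ≗-refl) (≗-trans (q^-⊛ e one f) (q^-cong e (⊛-identityˡ f)))

⊛-distribˡ-⊕ : ∀ f g h → f ⊛ (g ⊕ h) ≗ f ⊛ g ⊕ f ⊛ h
⊛-distribˡ-⊕ f g h n = trans
  (cong sumℤ (map-cong (λ k → ℤP.*-distribˡ-+ (f k) (g (n ∸ k)) (h (n ∸ k))) (upTo (suc n))))
  (sumℤ-map-+ (λ k → f k ℤ.* g (n ∸ k)) (λ k → f k ℤ.* h (n ∸ k)) (upTo (suc n)))

⊛-distribʳ-⊕ : ∀ f g h → (g ⊕ h) ⊛ f ≗ g ⊛ f ⊕ h ⊛ f
⊛-distribʳ-⊕ f g h n = trans
  (cong sumℤ (map-cong (λ k → ℤP.*-distribʳ-+ (f (n ∸ k)) (g k) (h k)) (upTo (suc n))))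
  (sumℤ-map-+ (λ k → g k ℤ.* f (n ∸ k)) (λ k → h k ℤ.* f (n ∸ k)) (upTo (suc n)))

⊛-distribʳ-⊖ : ∀ f g h → (g ⊖ h) ⊛ f ≗ g ⊛ f ⊖ h ⊛ f
⊛-distribʳ-⊖ f g h n = begin
  ((g ⊖ h) ⊛ f) n
    ≡⟨ cong sumℤ (map-cong distrib (upTo (suc n))) ⟩
  sumℤ (map (λ k → g k ℤ.* f (n ∸ k) ℤ.+ - (h k ℤ.* f (n ∸ k))) (upTo (suc n)))
    ≡⟨ sumℤ-map-+ (λ k → g k ℤ.* f (n ∸ k)) (λ k → - (h k ℤ.* f (n ∸ k))) (upTo (suc n)) ⟩
  (g ⊛ f) n ℤ.+ sumℤ (map (λ k → - (h k ℤ.* f (n ∸ k))) (upTo (suc n)))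
    ≡⟨ cong (λ s → (g ⊛ f) n ℤ.+ s) (sumℤ-map-neg (λ k → h k ℤ.* f (n ∸ k)) (upTo (suc n))) ⟩
  (g ⊛ f ⊖ h ⊛ f) n ∎
  where
  open ≡-Reasoning
  distrib : ∀ k → (g k ℤ.- h k) ℤ.* f (n ∸ k) ≡ g k ℤ.* f (n ∸ k) ℤ.+ - (h k ℤ.* f (n ∸ k))
  distrib k = trans (ℤP.*-distribʳ-+ (f (n ∸ k)) (g k) (- h k))
                    (cong (λ s → g k ℤ.* f (n ∸ k) ℤ.+ s) (sym (ℤP.neg-distribˡ-* (h k) (f (n ∸ k)))))

⊛-1+q^ : ∀ c f g → f ⊛ 1+q^ c · g ≗ 1+q^ c · (f ⊛ g)
⊛-1+q^ c f g = ≗-trans (⊛-distribˡ-⊕ f g (q^ c · g)) (⊕-congˡ (f ⊛ g) (⊛-q^ c f g))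

invList-one⊖X : ∀ n → invList (one ⊖ X^ 1) n ≡ replicate (suc n) (+ 1)
invList-one⊖X zero    = refl
invList-one⊖X (suc n) rewrite invList-one⊖X n =
  cong (_∷ replicate (suc n) (+ 1)) (begin
    - sumℤ (map F (upTo (suc n)))                       ≡⟨ cong (λ xs → - sumℤ xs) (map-upTo-suc F n) ⟩
    - (-[1+ 0 ] ℤ.+ sumℤ (map (λ _ → + 0) (upTo n)))    ≡⟨ cong (λ s → - (-[1+ 0 ] ℤ.+ s)) (sumℤ-map-0 (upTo n)) ⟩
    + 1                                                 ∎)
  where
  open ≡-Reasoning
  F : ℕ → ℤ
  F k = (one ⊖ X^ 1) (suc k) ℤ.* nth (replicate (suc n) (+ 1)) k

inv-one⊖X : inv (one ⊖ X^ 1) ≗ ones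
inv-one⊖X n = cong (λ xs → nth xs 0) (invList-one⊖X n)

[]q-suc : ∀ m → [ suc m ]q ≗ [ m ]q ⊕ q^ m · one
[]q-suc zero    zero    = refl
[]q-suc zero    (suc n) = refl
[]q-suc (suc m) zero    = refl
[]q-suc (suc m) (suc n) = []q-suc m n

[]q-suc′ : ∀ m → [ suc m ]q ≗ q· [ m ]q ⊕ one
[]q-suc′ m zero    = refl
[]q-suc′ m (suc n) = sym (ℤP.+-identityʳ ([ m ]q n))

[]q≗ones⊖q^·ones : ∀ m → [ m ]q ≗ ones ⊖ q^ m · ones
[]q≗ones⊖q^·ones zero    n       = refl
[]q≗ones⊖q^·ones (suc m) zero    = refl
[]q≗ones⊖q^·ones (suc m) (suc n) = []q≗ones⊖q^·ones m n

one⊖X^-⊛-inv : ∀ m → (one ⊖ X^ m) ⊛ inv (one ⊖ X^ 1) ≗ [ m ]q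
one⊖X^-⊛-inv m = begin
  (one ⊖ X^ m) ⊛ inv (one ⊖ X^ 1)  ≈⟨ ⊛-cong (≗-refl {one ⊖ X^ m}) inv-one⊖X ⟩
  (one ⊖ X^ m) ⊛ ones              ≈⟨ ⊛-distribʳ-⊖ ones one (X^ m) ⟩
  one ⊛ ones ⊖ X^ m ⊛ ones         ≈⟨ ⊖-cong (⊛-identityˡ ones) (X^-⊛ m ones) ⟩
  ones ⊖ q^ m · ones               ≈⟨ []q≗ones⊖q^·ones m ⟨
  [ m ]q                           ∎
  where open ≗-Reasoning

[suc]q-⊛ : ∀ a g → [ suc a ]q ⊛ g ≗ [ a ]q ⊛ g ⊕ q^ a · g
[suc]q-⊛ a g = begin
  [ suc a ]q ⊛ g                 ≈⟨ ⊛-cong ([]q-suc a) (≗-refl {g}) ⟩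
  ([ a ]q ⊕ q^ a · one) ⊛ g      ≈⟨ ⊛-distribʳ-⊕ g [ a ]q (q^ a · one) ⟩
  [ a ]q ⊛ g ⊕ q^ a · one ⊛ g    ≈⟨ ⊕-congˡ ([ a ]q ⊛ g) (q^-⊛ a one g) ⟩
  [ a ]q ⊛ g ⊕ q^ a · (one ⊛ g)  ≈⟨ ⊕-congˡ ([ a ]q ⊛ g) (q^-cong a (⊛-identityˡ g)) ⟩
  [ a ]q ⊛ g ⊕ q^ a · g          ∎
  where open ≗-Reasoning

[suc]q-⊛′ : ∀ a g → [ suc a ]q ⊛ g ≗ q· ([ a ]q ⊛ g) ⊕ g
[suc]q-⊛′ a g = begin
  [ suc a ]q ⊛ g             ≈⟨ ⊛-cong ([]q-suc′ a) (≗-refl {g}) ⟩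
  (q· [ a ]q ⊕ one) ⊛ g      ≈⟨ ⊛-distribʳ-⊕ g (q· [ a ]q) one ⟩
  q· [ a ]q ⊛ g ⊕ one ⊛ g    ≈⟨ ⊕-cong (q·-⊛ [ a ]q g) (⊛-identityˡ g) ⟩
  q· ([ a ]q ⊛ g) ⊕ g        ∎
  where open ≗-Reasoning

1+q^-[suc]q-⊛ : ∀ a g →
  1+q^ (suc a) · ([ suc a ]q ⊛ g) ≗ 1+q^ (2 + a) · ([ a ]q ⊛ g) ⊕ q^ a · 1+q^ 1 · g
1+q^-[suc]q-⊛ a g = begin
  G′ ⊕ q^ (suc a) · G′
    ≈⟨ ⊕-cong ([suc]q-⊛ a g) (q^-cong (suc a) ([suc]q-⊛′ a g)) ⟩
  (G ⊕ q^ a · g) ⊕ q^ (suc a) · (q· G ⊕ g)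
    ≈⟨ ⊕-congˡ (G ⊕ q^ a · g) (q^-⊕ (suc a) (q· G) g) ⟩
  (G ⊕ q^ a · g) ⊕ (q^ (suc a) · q· G ⊕ q^ (suc a) · g)
    ≈⟨ ⊕-interchange G (q^ a · g) (q^ (suc a) · q· G) (q^ (suc a) · g) ⟩
  (G ⊕ q^ (suc a) · q· G) ⊕ (q^ a · g ⊕ q^ (suc a) · g)
    ≈⟨ ⊕-cong (⊕-congˡ G (q·-cong (q^-comm a 1 G))) (⊕-congˡ (q^ a · g) (q^-comm 1 a g)) ⟩
  (G ⊕ q^ (2 + a) · G) ⊕ (q^ a · g ⊕ q^ a · q· g)
    ≈⟨ ⊕-congˡ (1+q^ (2 + a) · G) (q^-⊕ a g (q· g)) ⟨
  1+q^ (2 + a) · G ⊕ q^ a · 1+q^ 1 · g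
    ∎
  where
  open ≗-Reasoning
  G G′ : Series
  G  = [ a ]q ⊛ g
  G′ = [ suc a ]q ⊛ g

prodS-∷ʳ : ∀ c fs → prodS (fs ∷ʳ (one ⊕ X^ c)) ≗ 1+q^ c · prodS fs
prodS-∷ʳ c []       = ≗-trans (⊛-distribʳ-⊕ one one (X^ c)) (⊕-cong (⊛-identityˡ one) (X^-⊛ c one))
prodS-∷ʳ c (f ∷ fs) = ≗-trans (⊛-cong (≗-refl {f}) (prodS-∷ʳ c fs)) (⊛-1+q^ c f (prodS fs))

pochNegQ2-suc : ∀ j → pochNegQ2 (2 + j) ≗ 1+q^ (2 + j) · pochNegQ2 (1 + j)
pochNegQ2-suc j = begin
  prodS (map factor (upTo (suc j)))              ≡⟨ cong prodS (trans (cong (map factor) (sym (upTo-∷ʳ j)))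
                                                                      (map-++ factor (upTo j) (j ∷ []))) ⟩
  prodS (map factor (upTo j) ∷ʳ factor j)        ≈⟨ prodS-∷ʳ (j + 2) (map factor (upTo j)) ⟩
  1+q^ (j + 2) · pochNegQ2 (1 + j)               ≡⟨ cong (1+q^_· pochNegQ2 (1 + j)) (ℕP.+-comm j 2) ⟩
  1+q^ (2 + j) · pochNegQ2 (1 + j)               ∎
  where
  open ≗-Reasoning
  factor : ℕ → Series
  factor k = one ⊕ X^ (k + 2)

-- Hook lengths in partitions into distinct parts

conj-≤ : ∀ S {a j} → j ≤ a → conj (a ∷ S) j ≡ suc (conj S j)
conj-≤ S {j = j} j≤a = cong length (filter-accept (j ≤?_) j≤a)

conj-< : ∀ {S j} → All (_< j) S → conj S j ≡ 0
conj-< {j = j} S<j = cong length (filter-none (j ≤?_) (All.map ℕP.<⇒≱ S<j))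

-- Cell (i, j) of μ, counted from 0, lying in a row of length l, has hook length 2;
-- hook2InRow μ i l is the summand of hook2Count μ for that row.
HookTwo : List ℕ → ℕ → ℕ → ℕ → Set
HookTwo μ i l j = l + conj μ (suc j) + 1 ≡ suc i + suc j + 2

hookTwo? : ∀ μ i l → Decidable (HookTwo μ i l)
hookTwo? μ i l j = l + conj μ (suc j) + 1 ≟ suc i + suc j + 2

hook2InRow : List ℕ → ℕ → ℕ → ℕ
hook2InRow μ i l = length (filter (hookTwo? μ i l) (upTo l))

hook2InRow-∷ : ∀ {a S i l} → l ≤ a → hook2InRow (a ∷ S) (suc i) l ≡ hook2InRow S i l
hook2InRow-∷ {a} {S} {i} {l} l≤a =
  cong length (filter-≐-local (hookTwo? (a ∷ S) (suc i) l) (hookTwo? S i l) (All.map shift (AllP.all-upTo l)))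
  where
  shift : ∀ {j} → j < l → HookTwo (a ∷ S) (suc i) l j ⇔ HookTwo S i l j
  shift {j} j<l rewrite conj-≤ S (ℕP.≤-trans j<l l≤a) | ℕP.+-suc l (conj S (suc j)) =
    mk⇔ ℕP.suc-injective (cong suc)

hook2InRows-∷ : ∀ {a S ls} (g : ℕ → ℕ) → All (_≤ a) ls →
  sum (map (uncurry (hook2InRow (a ∷ S))) (zip (applyUpTo (suc ∘ g) (length ls)) ls)) ≡
  sum (map (uncurry (hook2InRow S)) (zip (applyUpTo g (length ls)) ls))
hook2InRows-∷ g []           = refl
hook2InRows-∷ g (l≤a ∷ ls≤a) = cong₂ _+_ (hook2InRow-∷ l≤a) (hook2InRows-∷ (g ∘ suc) ls≤a)

hook2Count-∷ : ∀ {a S} → All (_≤ a) S → hook2Count (a ∷ S) ≡ hook2InRow (a ∷ S) 0 a + hook2Count S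
hook2Count-∷ {a} {S} S≤a = cong (λ r → hook2InRow (a ∷ S) 0 a + r) (hook2InRows-∷ id S≤a)

upTo-2+ : ∀ K → upTo (2 + K) ≡ upTo K ++ (K ∷ []) ++ (suc K ∷ [])
upTo-2+ K = begin
  upTo (2 + K)                        ≡⟨ upTo-∷ʳ (suc K) ⟨
  upTo (suc K) ∷ʳ suc K               ≡⟨ cong (_∷ʳ suc K) (upTo-∷ʳ K) ⟨
  (upTo K ∷ʳ K) ∷ʳ suc K              ≡⟨ ++-assoc (upTo K) (K ∷ []) (suc K ∷ []) ⟩
  upTo K ++ (K ∷ []) ++ (suc K ∷ [])  ∎
  where open ≡-Reasoning

hookTwoInFirstRow⇔ : ∀ {K X j} → j ≤ suc K →
                    HookTwo (2 + K ∷ X) 0 (2 + K) j ⇔ K + conj X (suc j) ≡ j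
hookTwoInFirstRow⇔ {K} {X} {j} j≤1+K rewrite conj-≤ X (s≤s j≤1+K) =
  mk⇔ (λ e → ℕP.+-cancelʳ-≡ 2 (K + c) j (trans (sym arith) (ℕP.suc-injective (ℕP.suc-injective e))))
      (λ e → cong (λ n → 2 + n) (trans arith (cong (λ n → n + 2) e)))
  where
  c = conj X (suc j)
  arith : K + suc c + 1 ≡ K + c + 2
  arith = trans (cong (λ n → n + 1) (ℕP.+-suc K c)) (sym (ℕP.+-suc (K + c) 1))

-- Left of the cell with index K the arm alone is at least 2, and the last cell has hook length 1.
hook2InFirstRow : ∀ {K X} → All (_≤ suc K) X →
  hook2InRow (2 + K ∷ X) 0 (2 + K) ≡ length (filter (hookTwo? (2 + K ∷ X) 0 (2 + K)) (K ∷ []))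
hook2InFirstRow {K} {X} X≤1+K = cong length (begin
  filter P? (upTo (2 + K))
    ≡⟨ cong (filter P?) (upTo-2+ K) ⟩
  filter P? (upTo K ++ (K ∷ []) ++ (suc K ∷ []))
    ≡⟨ filter-++ P? (upTo K) ((K ∷ []) ++ (suc K ∷ [])) ⟩
  filter P? (upTo K) ++ filter P? ((K ∷ []) ++ (suc K ∷ []))
    ≡⟨ cong (filter P? (upTo K) ++_) (filter-++ P? (K ∷ []) (suc K ∷ [])) ⟩
  filter P? (upTo K) ++ filter P? (K ∷ []) ++ filter P? (suc K ∷ [])
    ≡⟨ cong₂ (λ xs ys → xs ++ filter P? (K ∷ []) ++ ys)
             (filter-none P? (All.map below (AllP.all-upTo K))) (filter-none P? (last ∷ [])) ⟩
  filter P? (K ∷ []) ++ []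
    ≡⟨ ++-identityʳ (filter P? (K ∷ [])) ⟩
  filter P? (K ∷ []) ∎)
  where
  open ≡-Reasoning
  P? = hookTwo? (2 + K ∷ X) 0 (2 + K)
  below : ∀ {j} → j < K → ¬ HookTwo (2 + K ∷ X) 0 (2 + K) j
  below {j} j<K h = ℕP.m+n≮m K (conj X (suc j))
    (subst (_< K) (sym (Equivalence.to (hookTwoInFirstRow⇔ (ℕP.m≤n⇒m≤1+n (ℕP.<⇒≤ j<K))) h)) j<K)
  last : ¬ HookTwo (2 + K ∷ X) 0 (2 + K) (suc K)
  last h = ℕP.1+n≢n (sym (begin
    K                     ≡⟨ ℕP.+-identityʳ K ⟨
    K + 0                 ≡⟨ cong (λ c → K + c) (conj-< (All.map s≤s X≤1+K)) ⟨
    K + conj X (2 + K)    ≡⟨ Equivalence.to (hookTwoInFirstRow⇔ ℕP.≤-refl) h ⟩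
    suc K                 ∎))

hook2Count-gap : ∀ {K S} → All (_≤ K) S → hook2Count (2 + K ∷ S) ≡ suc (hook2Count S)
hook2Count-gap {K} {S} S≤K = begin
  hook2Count (2 + K ∷ S)
    ≡⟨ hook2Count-∷ (All.map (ℕP.m≤n⇒m≤1+n ∘ ℕP.m≤n⇒m≤1+n) S≤K) ⟩
  hook2InRow (2 + K ∷ S) 0 (2 + K) + hook2Count S
    ≡⟨ cong (λ r → r + hook2Count S) (hook2InFirstRow (All.map ℕP.m≤n⇒m≤1+n S≤K)) ⟩
  length (filter P? (K ∷ [])) + hook2Count S
    ≡⟨ cong (λ xs → length xs + hook2Count S) (filter-accept P? hookTwoAtK) ⟩
  suc (hook2Count S) ∎
  where
  open ≡-Reasoning
  P? = hookTwo? (2 + K ∷ S) 0 (2 + K)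
  hookTwoAtK : HookTwo (2 + K ∷ S) 0 (2 + K) K
  hookTwoAtK = Equivalence.from (hookTwoInFirstRow⇔ (ℕP.n≤1+n K))
    (trans (cong (λ c → K + c) (conj-< (All.map s≤s S≤K))) (ℕP.+-identityʳ K))

hook2Count-noGap : ∀ {K S} → All (_≤ K) S → hook2Count (2 + K ∷ suc K ∷ S) ≡ hook2Count (suc K ∷ S)
hook2Count-noGap {K} {S} S≤K = begin
  hook2Count (2 + K ∷ suc K ∷ S)
    ≡⟨ hook2Count-∷ (ℕP.n≤1+n (suc K) ∷ All.map (ℕP.m≤n⇒m≤1+n ∘ ℕP.m≤n⇒m≤1+n) S≤K) ⟩
  hook2InRow (2 + K ∷ suc K ∷ S) 0 (2 + K) + hook2Count (suc K ∷ S)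
    ≡⟨ cong (λ r → r + hook2Count (suc K ∷ S)) (hook2InFirstRow (ℕP.≤-refl ∷ All.map ℕP.m≤n⇒m≤1+n S≤K)) ⟩
  length (filter P? (K ∷ [])) + hook2Count (suc K ∷ S)
    ≡⟨ cong (λ xs → length xs + hook2Count (suc K ∷ S)) (filter-reject P? noHookTwoAtK) ⟩
  hook2Count (suc K ∷ S) ∎
  where
  open ≡-Reasoning
  P? = hookTwo? (2 + K ∷ suc K ∷ S) 0 (2 + K)
  noHookTwoAtK : ¬ HookTwo (2 + K ∷ suc K ∷ S) 0 (2 + K) K
  noHookTwoAtK h = ℕP.m+1+n≢m K
    (trans (cong (λ c → K + c) (sym (conj-≤ S {suc K} ℕP.≤-refl))) (Equivalence.to (hookTwoInFirstRow⇔ (ℕP.n≤1+n K)) h))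

distinctPartsUpTo-bounded : ∀ L → All (All (_≤ L)) (distinctPartsUpTo L)
distinctPartsUpTo-bounded zero    = [] ∷ []
distinctPartsUpTo-bounded (suc L) =
  AllP.++⁺ (All.map (All.map ℕP.m≤n⇒m≤1+n) (distinctPartsUpTo-bounded L))
           (AllP.map⁺ (All.map (λ μ≤L → ℕP.≤-refl ∷ All.map ℕP.m≤n⇒m≤1+n μ≤L) (distinctPartsUpTo-bounded L)))

-- Generating functions

monomial : ℤ → ℕ → Series
monomial c e n = if does (e ≟ n) then c else + 0

monomial-+ : ∀ c d e → monomial (c ℤ.+ d) e ≗ monomial c e ⊕ monomial d e
monomial-+ c d e n with does (e ≟ n)
... | true  = refl
... | false = refl

monomial-q^ : ∀ a c e → monomial c (a + e) ≗ q^ a · monomial c e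
monomial-q^ zero    c e n       = refl
monomial-q^ (suc a) c e zero    = refl
monomial-q^ (suc a) c e (suc n) = monomial-q^ a c e n

generating : (List ℕ → ℕ) → List (List ℕ) → Series
generating w []       = 0S
generating w (μ ∷ xs) = monomial (+ w μ) (sum μ) ⊕ generating w xs

generating-filter : ∀ w xs n → + sum (map w (filter (λ μ → sum μ ≟ n) xs)) ≡ generating w xs n
generating-filter w []       n = refl
generating-filter w (μ ∷ xs) n with does (sum μ ≟ n)
... | true  = cong (λ s → + w μ ℤ.+ s) (generating-filter w xs n)
... | false = trans (generating-filter w xs n) (sym (ℤP.+-identityˡ _))

generating-++ : ∀ w xs ys → generating w (xs ++ ys) ≗ generating w xs ⊕ generating w ys
generating-++ w []       ys n = sym (ℤP.+-identityˡ _)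
generating-++ w (μ ∷ xs) ys =
  ≗-trans (⊕-congˡ (monomial (+ w μ) (sum μ)) (generating-++ w xs ys))
          (≗-sym (⊕-assoc (monomial (+ w μ) (sum μ)) (generating w xs) (generating w ys)))

generating-map-∷ : ∀ a w xs → generating w (map (a ∷_) xs) ≗ q^ a · generating (w ∘ (a ∷_)) xs
generating-map-∷ a w []       = ≗-sym (q^-0S a)
generating-map-∷ a w (μ ∷ xs) =
  ≗-trans (⊕-cong (monomial-q^ a (+ w (a ∷ μ)) (sum μ)) (generating-map-∷ a w xs))
          (≗-sym (q^-⊕ a (monomial (+ w (a ∷ μ)) (sum μ)) (generating (w ∘ (a ∷_)) xs)))

generating-cong : ∀ {w v} xs → All (λ μ → w μ ≡ v μ) xs → generating w xs ≗ generating v xs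
generating-cong []       []       = ≗-refl {0S}
generating-cong (μ ∷ xs) (e ∷ es) =
  ⊕-cong (λ n → cong (λ c → monomial (+ c) (sum μ) n) e) (generating-cong xs es)

generating-+ : ∀ v w xs → generating (λ μ → v μ + w μ) xs ≗ generating v xs ⊕ generating w xs
generating-+ v w []       n = refl
generating-+ v w (μ ∷ xs) =
  ≗-trans (⊕-cong (monomial-+ (+ v μ) (+ w μ) (sum μ)) (generating-+ v w xs))
          (⊕-interchange (monomial (+ v μ) (sum μ)) (monomial (+ w μ) (sum μ)) (generating v xs) (generating w xs))

b2Series : ℕ → Series
b2Series L = generating hook2Count (distinctPartsUpTo L)

distinctPartsSeries : ℕ → Series
distinctPartsSeries K = generating (λ _ → 1) (distinctPartsUpTo K)

b2Series-1 : b2Series 1 ≗ 0S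
b2Series-1 zero          = refl
b2Series-1 (suc zero)    = refl
b2Series-1 (suc (suc n)) = refl

distinctPartsSeries-0 : distinctPartsSeries 0 ≗ one
distinctPartsSeries-0 zero    = refl
distinctPartsSeries-0 (suc n) = refl

distinctPartsSeries-suc : ∀ K → distinctPartsSeries (suc K) ≗ 1+q^ (suc K) · distinctPartsSeries K
distinctPartsSeries-suc K =
  ≗-trans (generating-++ (λ _ → 1) (distinctPartsUpTo K) (map (suc K ∷_) (distinctPartsUpTo K)))
          (⊕-congˡ (distinctPartsSeries K) (generating-map-∷ (suc K) (λ _ → 1) (distinctPartsUpTo K)))

distinctPartsSeries-factor : ∀ j → distinctPartsSeries (suc j) ≗ 1+q^ 1 · pochNegQ2 (suc j)
distinctPartsSeries-factor zero    = ≗-trans (distinctPartsSeries-suc 0) (1+q^-cong 1 distinctPartsSeries-0)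
distinctPartsSeries-factor (suc j) = begin
  distinctPartsSeries (2 + j)                   ≈⟨ distinctPartsSeries-suc (suc j) ⟩
  1+q^ (2 + j) · distinctPartsSeries (1 + j)    ≈⟨ 1+q^-cong (2 + j) (distinctPartsSeries-factor j) ⟩
  1+q^ (2 + j) · 1+q^ 1 · pochNegQ2 (1 + j)     ≈⟨ 1+q^-comm (2 + j) 1 (pochNegQ2 (1 + j)) ⟩
  1+q^ 1 · 1+q^ (2 + j) · pochNegQ2 (1 + j)     ≈⟨ 1+q^-cong 1 (pochNegQ2-suc j) ⟨
  1+q^ 1 · pochNegQ2 (2 + j)                    ∎
  where open ≗-Reasoning

generating-hook2Count-∷ : ∀ K →
  generating (hook2Count ∘ (2 + K ∷_)) (distinctPartsUpTo (suc K)) ≗ distinctPartsSeries K ⊕ b2Series (suc K)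
generating-hook2Count-∷ K = begin
  generating h′ (D ++ map (suc K ∷_) D)
    ≈⟨ generating-++ h′ D (map (suc K ∷_) D) ⟩
  generating h′ D ⊕ generating h′ (map (suc K ∷_) D)
    ≈⟨ ⊕-cong (generating-cong D (All.map hook2Count-gap D-bounded))
              (generating-cong (map (suc K ∷_) D) (AllP.map⁺ (All.map hook2Count-noGap D-bounded))) ⟩
  generating (λ μ → 1 + hook2Count μ) D ⊕ generating hook2Count (map (suc K ∷_) D)
    ≈⟨ ⊕-cong (generating-+ (λ _ → 1) hook2Count D) (≗-refl {generating hook2Count (map (suc K ∷_) D)}) ⟩
  (distinctPartsSeries K ⊕ generating hook2Count D) ⊕ generating hook2Count (map (suc K ∷_) D)
    ≈⟨ ⊕-assoc (distinctPartsSeries K) (generating hook2Count D) (generating hook2Count (map (suc K ∷_) D)) ⟩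
  distinctPartsSeries K ⊕ (generating hook2Count D ⊕ generating hook2Count (map (suc K ∷_) D))
    ≈⟨ ⊕-congˡ (distinctPartsSeries K) (generating-++ hook2Count D (map (suc K ∷_) D)) ⟨
  distinctPartsSeries K ⊕ b2Series (suc K) ∎
  where
  open ≗-Reasoning
  D = distinctPartsUpTo K
  D-bounded = distinctPartsUpTo-bounded K
  h′ = hook2Count ∘ (2 + K ∷_)

b2Series-recurrence : ∀ K →
  b2Series (2 + K) ≗ 1+q^ (2 + K) · b2Series (1 + K) ⊕ q^ (2 + K) · distinctPartsSeries K
b2Series-recurrence K = begin
  generating hook2Count (distinctPartsUpTo (1 + K) ++ map (2 + K ∷_) (distinctPartsUpTo (1 + K)))
    ≈⟨ generating-++ hook2Count (distinctPartsUpTo (1 + K)) (map (2 + K ∷_) (distinctPartsUpTo (1 + K))) ⟩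
  B ⊕ generating hook2Count (map (2 + K ∷_) (distinctPartsUpTo (1 + K)))
    ≈⟨ ⊕-congˡ B (generating-map-∷ (2 + K) hook2Count (distinctPartsUpTo (1 + K))) ⟩
  B ⊕ q^ (2 + K) · generating (hook2Count ∘ (2 + K ∷_)) (distinctPartsUpTo (1 + K))
    ≈⟨ ⊕-congˡ B (q^-cong (2 + K) (generating-hook2Count-∷ K)) ⟩
  B ⊕ q^ (2 + K) · (P ⊕ B)
    ≈⟨ ⊕-congˡ B (q^-⊕ (2 + K) P B) ⟩
  B ⊕ (q^ (2 + K) · P ⊕ q^ (2 + K) · B)
    ≈⟨ ⊕-congˡ B (λ n → ℤP.+-comm ((q^ (2 + K) · P) n) ((q^ (2 + K) · B) n)) ⟩
  B ⊕ (q^ (2 + K) · B ⊕ q^ (2 + K) · P)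
    ≈⟨ ⊕-assoc B (q^ (2 + K) · B) (q^ (2 + K) · P) ⟨
  1+q^ (2 + K) · B ⊕ q^ (2 + K) · P ∎
  where
  open ≗-Reasoning
  B = b2Series (1 + K)
  P = distinctPartsSeries K

-- The closed form

closedForm : ℕ → Series
closedForm m = q^ 2 · ([ m ]q ⊛ pochNegQ2 m)

rhs≗closedForm : ∀ m → rhs m ≗ closedForm m
rhs≗closedForm m = begin
  X^ 2 ⊛ (one ⊖ X^ m) ⊛ I ⊛ Q
    ≈⟨ ⊛-cong (⊛-cong (X^-⊛ 2 (one ⊖ X^ m)) (≗-refl {I})) (≗-refl {Q}) ⟩
  q^ 2 · (one ⊖ X^ m) ⊛ I ⊛ Q
    ≈⟨ ⊛-cong (q^-⊛ 2 (one ⊖ X^ m) I) (≗-refl {Q}) ⟩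
  q^ 2 · ((one ⊖ X^ m) ⊛ I) ⊛ Q
    ≈⟨ q^-⊛ 2 ((one ⊖ X^ m) ⊛ I) Q ⟩
  q^ 2 · ((one ⊖ X^ m) ⊛ I ⊛ Q)
    ≈⟨ q^-cong 2 (⊛-cong (one⊖X^-⊛-inv m) (≗-refl {Q})) ⟩
  q^ 2 · ([ m ]q ⊛ Q) ∎
  where
  open ≗-Reasoning
  I = inv (one ⊖ X^ 1)
  Q = pochNegQ2 m

-- (-q²;q)_{-1} = 1/(1+q), the value of pochNegQ2 0, only ever occurs multiplied by [0]_q = 0.
closedForm-0 : closedForm 0 ≗ 0S
closedForm-0 = ≗-trans (q^-cong 2 (⊛-zeroˡ (pochNegQ2 0))) (q^-0S 2)

[1]q≗one : [ 1 ]q ≗ one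
[1]q≗one zero    = refl
[1]q≗one (suc n) = refl

closedForm-recurrence : ∀ K →
  closedForm (1 + K) ≗ 1+q^ (2 + K) · closedForm K ⊕ q^ (2 + K) · distinctPartsSeries K
closedForm-recurrence zero = begin
  q^ 2 · ([ 1 ]q ⊛ one)
    ≈⟨ q^-cong 2 (≗-trans (⊛-cong [1]q≗one (≗-refl {one})) (⊛-identityˡ one)) ⟩
  q^ 2 · one
    ≈⟨ (λ n → ℤP.+-identityˡ ((q^ 2 · one) n)) ⟨
  0S ⊕ q^ 2 · one
    ≈⟨ ⊕-cong (≗-trans (1+q^-cong 2 closedForm-0) (⊕-congˡ 0S (q^-0S 2))) (q^-cong 2 distinctPartsSeries-0) ⟨
  1+q^ 2 · closedForm 0 ⊕ q^ 2 · distinctPartsSeries 0 ∎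
  where open ≗-Reasoning
closedForm-recurrence (suc j) = begin
  q^ 2 · ([ 2 + j ]q ⊛ pochNegQ2 (2 + j))
    ≈⟨ q^-cong 2 (⊛-cong (≗-refl {[ 2 + j ]q}) (pochNegQ2-suc j)) ⟩
  q^ 2 · ([ 2 + j ]q ⊛ 1+q^ (2 + j) · Q)
    ≈⟨ q^-cong 2 (⊛-1+q^ (2 + j) [ 2 + j ]q Q) ⟩
  q^ 2 · 1+q^ (2 + j) · ([ 2 + j ]q ⊛ Q)
    ≈⟨ q^-cong 2 (1+q^-[suc]q-⊛ (suc j) Q) ⟩
  q^ 2 · (1+q^ (3 + j) · ([ 1 + j ]q ⊛ Q) ⊕ q^ (1 + j) · 1+q^ 1 · Q)
    ≈⟨ q^-⊕ 2 (1+q^ (3 + j) · ([ 1 + j ]q ⊛ Q)) (q^ (1 + j) · 1+q^ 1 · Q) ⟩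
  q^ 2 · 1+q^ (3 + j) · ([ 1 + j ]q ⊛ Q) ⊕ q^ (3 + j) · 1+q^ 1 · Q
    ≈⟨ ⊕-cong (q^-1+q^ 2 (3 + j) ([ 1 + j ]q ⊛ Q)) (q^-cong (3 + j) (≗-sym (distinctPartsSeries-factor j))) ⟩
  1+q^ (3 + j) · closedForm (1 + j) ⊕ q^ (3 + j) · distinctPartsSeries (1 + j) ∎
  where
  open ≗-Reasoning
  Q = pochNegQ2 (1 + j)

b2Series≗closedForm : ∀ m → b2Series (suc m) ≗ closedForm m
b2Series≗closedForm zero    = ≗-trans b2Series-1 (≗-sym closedForm-0)
b2Series≗closedForm (suc K) = begin
  b2Series (2 + K)
    ≈⟨ b2Series-recurrence K ⟩
  1+q^ (2 + K) · b2Series (1 + K) ⊕ q^ (2 + K) · distinctPartsSeries K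
    ≈⟨ ⊕-cong (1+q^-cong (2 + K) (b2Series≗closedForm K)) (≗-refl {q^ (2 + K) · distinctPartsSeries K}) ⟩
  1+q^ (2 + K) · closedForm K ⊕ q^ (2 + K) · distinctPartsSeries K
    ≈⟨ closedForm-recurrence K ⟨
  closedForm (1 + K) ∎
  where open ≗-Reasoning

theorem2p2 : (m n : ℕ) → + b2 (suc m) n ≡ rhs m n
theorem2p2 m n = begin
  + b2 (suc m) n        ≡⟨ generating-filter hook2Count (distinctPartsUpTo (suc m)) n ⟩
  b2Series (suc m) n    ≡⟨ b2Series≗closedForm m n ⟩
  closedForm m n        ≡⟨ rhs≗closedForm m n ⟨
  rhs m n               ∎
  where open ≡-Reasoning
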